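{- Let $\Gamma$ be a connected graph, let $G$ be a vertex-transitive subgroup of $\mathrm{Aut}(\Gamma)$, and let $\beta_1, \ldots, \beta_d$ be a complete set of representatives of the $G$-orbits on the set of $G$-consistent cycles of $\Gamma$ such that $m(\beta_i, \beta_j) = m(\beta_i^G, \beta_j^G)$ for all $i \neq j$. For each $i$ choose a shunt $g_i \in G$ of $\beta_i$, and let $S = \langle g_1, \ldots, g_d \rangle$. Let $\tau$ be a $G$-consistent walk and let $H \leq G$ be a subgroup with $G_\tau \leq H$ and $S \subseteq H$. Then $H = G$.
   Context: All graphs are finite and simple with at least three vertices. Automorphisms act on the right and act on tuples of vertices coordinatewise; $G_\tau$ is the subgroup of $G$ fixing every vertex of $\tau$. A walk of length $n \geq 1$ is a tuple $(v_0, \ldots, v_n)$ of vertices with consecutive vertices adjacent; it is $G$-consistent if there is $g \in G$ (a shunt) with $v_i^g = v_{i+1}$ for all $i \in \{0, \ldots, n-1\}$. A walk $(v_0, \ldots, v_n)$ is a cycle if $v_0 = v_n$ and $v_0, \ldots, v_{n-1}$ are pairwise distinct (cycles are directed and rooted; in particular $(u,v,u)$ for adjacent $u,v$ is a cycle of length 2). $G$ acts on the set of $G$-consistent cycles; for a $d$-valent graph and vertex-transitive $G$ there are exactly $d$ orbits. For walks $\alpha = (a_0, \ldots, a_k)$ and $\beta = (b_0, \ldots, b_\ell)$ the overlap is $m(\alpha, \beta) = -1$ if $a_0 \neq b_0$, and otherwise $m(\alpha,\beta) = \max\{t : a_i = b_i \text{ for } i = 0, 1, \ldots, t\}$; for $G$-orbits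 $A, B$ of walks, $m(A,B) = \max\{m(\alpha,\beta) : \alpha \in A, \beta \in B\}$. -}

module Defs where

open import Level using (0ℓ)
open import Data.Nat using (ℕ; zero; suc; _≤_)
open import Data.Integer using (ℤ; +_; -[1+_]; _≤_)
open import Data.Fin using (Fin; zero; suc; inject₁; fromℕ)
open import Data.Fin.Permutation using (Permutation′; _⟨$⟩ʳ_; id; flip; _∘ₚ_; _≈_)
open import Data.Vec using (Vec; []; _∷_; lookup; map)
open import Data.Product using (Σ; ∃; _×_; _,_)
open import Relation.Binary.PropositionalEquality using (_≡_; _≢_)
open import Relation.Nullary using (¬_; Dec; yes; no)
open import Data.Fin.Properties using (_≟_)

record Graph (n : ℕ) : Set₁ where
  field
    Adj    : Fin n → Fin n → Set
    adj?   : ∀ u v → Dec (Adj u v)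
    sym    : ∀ {u v} → Adj u v → Adj v u
    irrefl : ∀ {u} → ¬ Adj u u

open Graph public

data Reachable {n : ℕ} (Γ : Graph n) : Fin n → Fin n → Set where
  here : ∀ {u} → Reachable Γ u u
  step : ∀ {u w v} → Adj Γ u w → Reachable Γ w v → Reachable Γ u v

Connected : ∀ {n} → Graph n → Set
Connected Γ = ∀ u v → Reachable Γ u v

-- Permutations act on the right: v ^ g = g ⟨$⟩ʳ v ; g ∘ₚ h = "first g then h".
Perm : ℕ → Set
Perm n = Permutation′ n

IsAut : ∀ {n} → Graph n → Perm n → Set
IsAut Γ g = ∀ u v → (Adj Γ u v → Adj Γ (g ⟨$⟩ʳ u) (g ⟨$⟩ʳ v))
                  × (Adj Γ (g ⟨$⟩ʳ u) (g ⟨$⟩ʳ v) → Adj Γ u v)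

record PermGroup (n : ℕ) : Set₁ where
  field
    _∈G_  : Perm n → Set
    resp  : ∀ {g h} → g ≈ h → _∈G_ g → _∈G_ h
    idG   : _∈G_ id
    compG : ∀ {g h} → _∈G_ g → _∈G_ h → _∈G_ (g ∘ₚ h)
    invG  : ∀ {g} → _∈G_ g → _∈G_ (flip g)

open PermGroup public

SubgroupOfAut : ∀ {n} → Graph n → PermGroup n → Set
SubgroupOfAut Γ G = ∀ g → _∈G_ G g → IsAut Γ g

VertexTransitive : ∀ {n} → PermGroup n → Set
VertexTransitive G = ∀ u v → Σ (Perm _) λ g → _∈G_ G g × (g ⟨$⟩ʳ u ≡ v)

_⊆G_ : ∀ {n} → PermGroup n → PermGroup n → Set
H ⊆G K = ∀ g → _∈G_ H g → _∈G_ K g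

data Generated {n d : ℕ} (gs : Fin d → Perm n) : Perm n → Set where
  gen  : ∀ i → Generated gs (gs i)
  respS : ∀ {g h} → g ≈ h → Generated gs g → Generated gs h
  idS  : Generated gs id
  comp : ∀ {g h} → Generated gs g → Generated gs h → Generated gs (g ∘ₚ h)
  inv  : ∀ {g} → Generated gs g → Generated gs (flip g)

-- Walks: a tuple (v₀,…,v_k) of length k = suc len ≥ 1

record Tuple (n : ℕ) : Set where
  constructor tuple
  field
    len : ℕ
    vs  : Vec (Fin n) (suc (suc len))

open Tuple public

IsWalk : ∀ {n} → Graph n → Tuple n → Set
IsWalk Γ w = ∀ (i : Fin (suc (len w))) →
  Adj Γ (lookup (vs w) (inject₁ i)) (lookup (vs w) (suc i))

_^_ : ∀ {n} → Tuple n → Perm n → Tuple n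
w ^ g = tuple (len w) (map (g ⟨$⟩ʳ_) (vs w))

IsShunt : ∀ {n} → Perm n → Tuple n → Set
IsShunt g w = ∀ (i : Fin (suc (len w))) →
  g ⟨$⟩ʳ lookup (vs w) (inject₁ i) ≡ lookup (vs w) (suc i)

Consistent : ∀ {n} → Graph n → PermGroup n → Tuple n → Set
Consistent Γ G w = IsWalk Γ w × Σ (Perm _) λ g → _∈G_ G g × IsShunt g w

IsCycle : ∀ {n} → Graph n → Tuple n → Set
IsCycle Γ w = IsWalk Γ w
  × (lookup (vs w) zero ≡ lookup (vs w) (fromℕ (suc (len w))))
  × (∀ (i j : Fin (suc (len w))) →
       lookup (vs w) (inject₁ i) ≡ lookup (vs w) (inject₁ j) → i ≡ j)

ConsistentCycle : ∀ {n} → Graph n → PermGroup n → Tuple n → Set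
ConsistentCycle Γ G w = IsCycle Γ w × Consistent Γ G w

InOrbit : ∀ {n} → PermGroup n → Tuple n → Tuple n → Set
InOrbit G w w' = Σ (Perm _) λ g → _∈G_ G g × (w ^ g ≡ w')

commonPrefix : ∀ {n k l} → Vec (Fin n) k → Vec (Fin n) l → ℕ
commonPrefix []       _        = zero
commonPrefix (_ ∷ _)  []       = zero
commonPrefix (a ∷ as) (b ∷ bs) with a ≟ b
... | yes _ = suc (commonPrefix as bs)
... | no  _ = zero

-- m(α,β) = -1 if a₀ ≠ b₀, else the largest t with aᵢ = bᵢ for i = 0,…,t
overlapM : ∀ {n} → Tuple n → Tuple n → ℤ
overlapM α β with commonPrefix (vs α) (vs β)
... | zero  = -[1+ 0 ]
... | suc t = + t

-- "m(Aᴳ, Bᴳ) = k": k is the maximum of m(α', β') over α' ∈ αᴳ, β' ∈ βᴳ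
OrbitOverlapIs : ∀ {n} → PermGroup n → Tuple n → Tuple n → ℤ → Set
OrbitOverlapIs G α β k =
    (Σ (Perm _) λ g → Σ (Perm _) λ h → _∈G_ G g × _∈G_ G h × (overlapM (α ^ g) (β ^ h) ≡ k))
  × (∀ g h → _∈G_ G g → _∈G_ G h → overlapM (α ^ g) (β ^ h) Data.Integer.≤ k)

InStabiliser : ∀ {n} → PermGroup n → Tuple n → Perm n → Set
InStabiliser G τ g = _∈G_ G g × (∀ i → g ⟨$⟩ʳ lookup (vs τ) i ≡ lookup (vs τ) i)

-- Each shunt gᵢ unrolls βᵢ into the periodic vertex sequence orb i = (vᵢ, vᵢ^gᵢ, vᵢ^gᵢ², …).
-- An element h ∈ G moving a vertex a to a neighbour shunts a G-consistent cycle, so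
-- (a, a^h, a^h², …) is a G-image of some orb i. The overlap hypothesis makes these sequences
-- rigid: if y ∈ G maps an initial segment of orb i onto one of orb j, the two segments already
-- coincide (in particular all βᵢ start at one vertex). By downward induction on k, whatever an
-- element z ∈ G fixing the first k + 1 vertices of βⱼ does to the next vertex, some element of S
-- fixing them does as well: z gⱼ shunts a cycle βᵢ^y that agrees with βⱼ one vertex further, and
-- gᵢ s gⱼ⁻¹ works for the s supplied for βᵢ. Hence S moves initial segments of every βᵢ exactly
-- as G does; by connectivity S is vertex-transitive, every G-consistent walk τ is an S-image of
-- such a segment, and so G = G_τ S ⊆ H.
{-# OPTIONS --safe #-}
module Submission where

open import Defs hiding (sym)
open import Data.Nat using (ℕ; _≤_)
open import Data.Fin using (Fin)
open import Data.Product using (Σ; _×_)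
open import Relation.Binary.PropositionalEquality using (_≢_)
open import Relation.Nullary using (¬_)

open import Level using (0ℓ)
open import Data.Nat
  using (zero; suc; _+_; _*_; _∸_; _<_; _⊓_; z≤n; s≤s; s≤s⁻¹; z<s; NonZero)
open import Data.Nat.Properties
  using ( ≤-refl; ≤-trans; ≤-reflexive; ≤-antisym; ≤-total; <⇒≤; <⇒≢; ≮⇒≥; n<1+n
        ; m≤n⇒m≤1+n; m≤n⇒m<n∨m≡n; m≤n⇒∃[o]m+o≡n; m≤m+n; m≤n+m; m∸n≤m; m∸n+n≡m
        ; +-suc; +-identityʳ; +-assoc; ⊓-glb; m⊓n≤m; m⊓n≤n )
open import Data.Nat.DivMod using (_/_; _%_; m≡m%n+[m/n]*n; m%n<n)
open import Data.Nat.GeneralisedArithmetic using (fold; fold-+)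
open import Data.Fin using (zero; suc; toℕ; inject₁; fromℕ; fromℕ<) renaming (_<_ to _<ᶠ_)
open import Data.Fin.Properties
  using (_≟_; toℕ<n; toℕ-inject₁; toℕ-fromℕ; toℕ-fromℕ<; pigeonhole; injective⇒≤)
  renaming (<-cmp to <ᶠ-cmp)
open import Data.Fin.Permutation
  using (_⟨$⟩ʳ_; _⟨$⟩ˡ_; id; flip; _∘ₚ_; _≈_; inverseˡ; inverseʳ)
open import Data.Vec using (Vec; []; _∷_; lookup; tabulate; map)
open import Data.Vec.Properties using (lookup∘tabulate; tabulate-∘; tabulate-cong)
open import Data.Product using (∃; _,_; proj₁; proj₂)
open import Data.Sum using (inj₁; inj₂)
open import Data.Integer using (+_; +≤+) renaming (_≤_ to _≤ℤ_)
open import Data.Integer.Properties using () renaming (≤-trans to ≤ℤ-trans)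
open import Function using (_∘_; Injective)
open import Function.Bundles using (Injection)
open import Function.Properties.Inverse using (↔⇒↣)
open import Relation.Binary using (tri<; tri≈; tri>)
open import Relation.Binary.PropositionalEquality
  using (_≡_; refl; sym; trans; cong; subst; subst₂; module ≡-Reasoning)
open import Relation.Nullary using (yes; no; contradiction)
open import Relation.Unary using (Pred; Decidable; _∈_; _⊆_)

open ≡-Reasoning

private
  variable
    A : Set

Agree : ℕ → (ℕ → A) → (ℕ → A) → Set
Agree k f g = ∀ t → t ≤ k → f t ≡ g t

Agree-mono : ∀ {k′ k} {f g : ℕ → A} → k′ ≤ k → Agree k f g → Agree k′ f g
Agree-mono k′≤k agree t t≤k′ = agree t (≤-trans t≤k′ k′≤k)

Agree-sym : ∀ {k} {f g : ℕ → A} → Agree k f g → Agree k g f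
Agree-sym agree t t≤k = sym (agree t t≤k)

Agree-suc : ∀ {k} {f g : ℕ → A} → Agree k f g → f (suc k) ≡ g (suc k) → Agree (suc k) f g
Agree-suc agree next t t≤1+k with m≤n⇒m<n∨m≡n t≤1+k
... | inj₁ t<1+k = agree t (s≤s⁻¹ t<1+k)
... | inj₂ refl  = next

Periodic : ℕ → (ℕ → A) → Set
Periodic p f = ∀ s → f (s + p) ≡ f s

periodic-+* : ∀ {p} {f : ℕ → A} → Periodic p f → ∀ q s → f (s + q * p) ≡ f s
periodic-+* {f = f} per zero    s = cong f (+-identityʳ s)
periodic-+* {p = p} {f = f} per (suc q) s = begin
  f (s + (p + q * p)) ≡⟨ cong f (+-assoc s p (q * p)) ⟨
  f (s + p + q * p)   ≡⟨ periodic-+* per q (s + p) ⟩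
  f (s + p)           ≡⟨ per s ⟩
  f s                 ∎

periodic-∸ : ∀ {p t} {f : ℕ → A} → Periodic p f → p ≤ t → f t ≡ f (t ∸ p)
periodic-∸ {f = f} per p≤t = trans (cong f (sym (m∸n+n≡m p≤t))) (per _)

periodic-agree : ∀ {p} .{{_ : NonZero p}} {f g : ℕ → A} → Periodic p f → Periodic p g →
  (∀ t → t < p → f t ≡ g t) → ∀ t → f t ≡ g t
periodic-agree {p = p} {f} {g} per-f per-g below t = begin
  f t                     ≡⟨ cong f (m≡m%n+[m/n]*n t p) ⟩
  f (t % p + t / p * p)   ≡⟨ periodic-+* per-f (t / p) (t % p) ⟩
  f (t % p)               ≡⟨ below (t % p) (m%n<n t p) ⟩
  g (t % p)               ≡⟨ periodic-+* per-g (t / p) (t % p) ⟨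
  g (t % p + t / p * p)   ≡⟨ cong g (m≡m%n+[m/n]*n t p) ⟨
  g t                     ∎

least-witness : ∀ {P : Pred ℕ 0ℓ} → Decidable P → ∃ P → ∃ λ l → P l × (∀ {t} → t < l → ¬ P t)
least-witness P? witness with P? 0
... | yes P0 = 0 , P0 , λ ()
least-witness P? (zero  , P0) | no ¬P0 = contradiction P0 ¬P0
least-witness P? (suc m , Pm) | no ¬P0 with least-witness (P? ∘ suc) (m , Pm)
... | l , Pl , below = suc l , Pl , λ { {zero} _ → ¬P0 ; {suc t} t<l → below (s≤s⁻¹ t<l) }

distinct⇒injective : ∀ {m} (f : Fin m → A) → (∀ {i j} → i <ᶠ j → f i ≢ f j) →
  Injective _≡_ _≡_ f
distinct⇒injective f distinct {i} {j} same with <ᶠ-cmp i j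
... | tri< i<j _ _ = contradiction same (distinct i<j)
... | tri≈ _ i≡j _ = i≡j
... | tri> _ _ j<i = contradiction (sym same) (distinct j<i)

fold-seed : ∀ (f : A → A) x t → fold (f x) f t ≡ f (fold x f t)
fold-seed f x zero    = refl
fold-seed f x (suc t) = cong f (fold-seed f x t)

tabulate-fold : ∀ {m} (f : A → A) (xs : Vec A (suc m)) →
  (∀ i → f (lookup xs (inject₁ i)) ≡ lookup xs (suc i)) →
  xs ≡ tabulate (fold (lookup xs zero) f ∘ toℕ)
tabulate-fold f (x ∷ [])     _    = refl
tabulate-fold f (x ∷ y ∷ ys) shift = cong (x ∷_) (begin
  y ∷ ys                        ≡⟨ tabulate-fold f (y ∷ ys) (shift ∘ suc) ⟩
  tabulate (fold y f ∘ toℕ)     ≡⟨ cong (λ z → tabulate (fold z f ∘ toℕ)) (shift zero) ⟨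
  tabulate (fold (f x) f ∘ toℕ) ≡⟨ tabulate-cong (fold-seed f x ∘ toℕ) ⟩
  tabulate (f ∘ fold x f ∘ toℕ) ∎)

lookup-inject₁-tabulate : ∀ {m} (f : ℕ → A) (i : Fin m) →
  lookup (tabulate (f ∘ toℕ)) (inject₁ i) ≡ f (toℕ i)
lookup-inject₁-tabulate f i = trans (lookup∘tabulate (f ∘ toℕ) (inject₁ i)) (cong f (toℕ-inject₁ i))

tabulate-agree : ∀ {m} {f g : ℕ → A} → tabulate {n = m} (f ∘ toℕ) ≡ tabulate (g ∘ toℕ) →
  ∀ t → t < m → f t ≡ g t
tabulate-agree {f = f} {g} same t t<m = begin
  f t                           ≡⟨ cong f (toℕ-fromℕ< t<m) ⟨
  f (toℕ i)                     ≡⟨ lookup∘tabulate (f ∘ toℕ) i ⟨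
  lookup (tabulate (f ∘ toℕ)) i ≡⟨ cong (λ xs → lookup xs i) same ⟩
  lookup (tabulate (g ∘ toℕ)) i ≡⟨ lookup∘tabulate (g ∘ toℕ) i ⟩
  g (toℕ i)                     ≡⟨ cong g (toℕ-fromℕ< t<m) ⟩
  g t                           ∎
  where i = fromℕ< t<m

commonPrefix-tabulate⁺ : ∀ {n m m′} (f g : ℕ → Fin n) k → k < m → k < m′ → Agree k f g →
  suc k ≤ commonPrefix (tabulate {n = m} (f ∘ toℕ)) (tabulate {n = m′} (g ∘ toℕ))
commonPrefix-tabulate⁺ {m = suc _} {suc _} f g k _ _ agree with f 0 ≟ g 0
... | no f0≢g0 = contradiction (agree 0 z≤n) f0≢g0
commonPrefix-tabulate⁺ {m = suc _} {suc _} f g zero    _ _ _ | yes _ = s≤s z≤n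
commonPrefix-tabulate⁺ {m = suc m} {suc m′} f g (suc k) (s≤s k<m) (s≤s k<m′) agree | yes _ =
  s≤s (commonPrefix-tabulate⁺ {m = m} {m′} (f ∘ suc) (g ∘ suc) k k<m k<m′
         (λ t t≤k → agree (suc t) (s≤s t≤k)))

commonPrefix-tabulate⁻ : ∀ {n m m′} (f g : ℕ → Fin n) k →
  suc k ≤ commonPrefix (tabulate {n = m} (f ∘ toℕ)) (tabulate {n = m′} (g ∘ toℕ)) → Agree k f g
commonPrefix-tabulate⁻ {m = zero}          f g k ()
commonPrefix-tabulate⁻ {m = suc _} {zero}  f g k ()
commonPrefix-tabulate⁻ {m = suc _} {suc _} f g k prefix t t≤k with f 0 ≟ g 0
commonPrefix-tabulate⁻ {m = suc _} {suc _} f g k ()  t _ | no _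
commonPrefix-tabulate⁻ {m = suc _} {suc _} f g k _ zero _ | yes f0≡g0 = f0≡g0
commonPrefix-tabulate⁻ {m = suc m} {suc m′} f g (suc k) (s≤s prefix) (suc t) (s≤s t≤k) | yes _ =
  commonPrefix-tabulate⁻ {m = m} {m′} (f ∘ suc) (g ∘ suc) k prefix t t≤k

≤-overlapM⁺ : ∀ {n} (α β : Tuple n) {k} → suc k ≤ commonPrefix (vs α) (vs β) → + k ≤ℤ overlapM α β
≤-overlapM⁺ α β 1+k≤prefix with commonPrefix (vs α) (vs β)
≤-overlapM⁺ α β ()            | zero
≤-overlapM⁺ α β (s≤s k≤prefix) | suc _ = +≤+ k≤prefix

≤-overlapM⁻ : ∀ {n} (α β : Tuple n) {k} → + k ≤ℤ overlapM α β → suc k ≤ commonPrefix (vs α) (vs β)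
≤-overlapM⁻ α β k≤overlap with commonPrefix (vs α) (vs β)
≤-overlapM⁻ α β ()           | zero
≤-overlapM⁻ α β (+≤+ k≤c)    | suc _ = s≤s k≤c

overlapM-agree⁺ : ∀ {n} {α β : Tuple n} {f g : ℕ → Fin n} {k} →
  vs α ≡ tabulate (f ∘ toℕ) → vs β ≡ tabulate (g ∘ toℕ) →
  k ≤ suc (len α) → k ≤ suc (len β) → Agree k f g → + k ≤ℤ overlapM α β
overlapM-agree⁺ {α = tuple _ _} {tuple _ _} {f} {g} {k} refl refl k≤α k≤β agree =
  ≤-overlapM⁺ _ _ (commonPrefix-tabulate⁺ f g k (s≤s k≤α) (s≤s k≤β) agree)

overlapM-agree⁻ : ∀ {n} {α β : Tuple n} {f g : ℕ → Fin n} {k} →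
  vs α ≡ tabulate (f ∘ toℕ) → vs β ≡ tabulate (g ∘ toℕ) → + k ≤ℤ overlapM α β → Agree k f g
overlapM-agree⁻ {α = α@(tuple _ _)} {β@(tuple _ _)} {f} {g} {k} refl refl k≤overlap =
  commonPrefix-tabulate⁻ f g k (≤-overlapM⁻ α β k≤overlap)

tuple-≡-agree : ∀ {n l₁ l₂} {xs : Vec (Fin n) (suc (suc l₁))} {ys : Vec (Fin n) (suc (suc l₂))}
  {f g : ℕ → Fin n} → tuple l₁ xs ≡ tuple l₂ ys →
  xs ≡ tabulate (f ∘ toℕ) → ys ≡ tabulate (g ∘ toℕ) → l₁ ≡ l₂ × Agree (suc l₁) f g
tuple-≡-agree {f = f} {g} refl refl same =
  refl , λ t t≤ → tabulate-agree {f = f} {g} same t (s≤s t≤)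

orbit : ∀ {n} → Perm n → Fin n → ℕ → Fin n
orbit g a = fold a (g ⟨$⟩ʳ_)

orbit-+ : ∀ {n} (g : Perm n) a s t → orbit g a (s + t) ≡ orbit g (orbit g a t) s
orbit-+ g a s t = fold-+ a (g ⟨$⟩ʳ_) s

orbit-periodic : ∀ {n} {g : Perm n} {a p} → orbit g a p ≡ a → Periodic p (orbit g a)
orbit-periodic {g = g} {a} {p} returns s =
  trans (orbit-+ g a s p) (cong (λ b → orbit g b s) returns)

⟨$⟩ʳ-injective : ∀ {n} (g : Perm n) {a b} → g ⟨$⟩ʳ a ≡ g ⟨$⟩ʳ b → a ≡ b
⟨$⟩ʳ-injective g = Injection.injective (↔⇒↣ g)

orbit-injective : ∀ {n} (g : Perm n) t {a b} → orbit g a t ≡ orbit g b t → a ≡ b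
orbit-injective g zero    same = same
orbit-injective g (suc t) same = orbit-injective g t (⟨$⟩ʳ-injective g same)

orbit-return-gap : ∀ {n} (g : Perm n) {a} s r → orbit g a s ≡ orbit g a (suc s + r) →
  orbit g a (suc r) ≡ a
orbit-return-gap g {a} s r same = orbit-injective g s (begin
  orbit g (orbit g a (suc r)) s ≡⟨ orbit-+ g a s (suc r) ⟨
  orbit g a (s + suc r)         ≡⟨ cong (orbit g a) (+-suc s r) ⟩
  orbit g a (suc s + r)         ≡⟨ same ⟨
  orbit g a s                   ∎)

orbit-returns : ∀ {n} (g : Perm n) a → ∃ λ r → orbit g a (suc r) ≡ a
orbit-returns {n} g a with pigeonhole (n<1+n n) (orbit g a ∘ toℕ)
... | i , j , i<j , same with m≤n⇒∃[o]m+o≡n i<j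
... | r , i+1+r≡j = r , orbit-return-gap g (toℕ i) r (trans same (cong (orbit g a) (sym i+1+r≡j)))

orbit-distinct : ∀ {n} {g : Perm n} {a l} → (∀ {t} → t < l → orbit g a (suc t) ≢ a) →
  ∀ {s t} → s < t → t ≤ l → orbit g a s ≢ orbit g a t
orbit-distinct {g = g} {a} {l} minimal {s} {t} s<t t≤l same with m≤n⇒∃[o]m+o≡n s<t
... | r , s+1+r≡t =
  minimal r<l (orbit-return-gap g s r (trans same (cong (orbit g a) (sym s+1+r≡t))))
  where
  r<l : r < l
  r<l = ≤-trans (s≤s (m≤n+m r s)) (≤-trans (≤-reflexive s+1+r≡t) t≤l)

orbitTuple : ∀ {n} → Perm n → Fin n → ℕ → Tuple n
orbitTuple g a l = tuple l (tabulate (orbit g a ∘ toℕ))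

orbitTuple-shunt : ∀ {n} (g : Perm n) a l → IsShunt g (orbitTuple g a l)
orbitTuple-shunt g a l i =
  trans (cong (g ⟨$⟩ʳ_) (lookup-inject₁-tabulate (orbit g a) i))
        (sym (lookup∘tabulate (orbit g a ∘ toℕ) (suc i)))

shunt-tabulate : ∀ {n} (g : Perm n) (w : Tuple n) → IsShunt g w →
  vs w ≡ tabulate (orbit g (lookup (vs w) zero) ∘ toℕ)
shunt-tabulate g w shunt = tabulate-fold (g ⟨$⟩ʳ_) (vs w) shunt

shunt-lookup : ∀ {n} (g : Perm n) (w : Tuple n) → IsShunt g w →
  ∀ i → lookup (vs w) i ≡ orbit g (lookup (vs w) zero) (toℕ i)
shunt-lookup g w shunt i = trans (cong (λ xs → lookup xs i) (shunt-tabulate g w shunt))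
                                      (lookup∘tabulate (orbit g (lookup (vs w) zero) ∘ toℕ) i)

module _ {n} (Γ : Graph n) where

  orbit-adjacent : ∀ {g a} → IsAut Γ g → Adj Γ a (g ⟨$⟩ʳ a) →
    ∀ t → Adj Γ (orbit g a t) (orbit g a (suc t))
  orbit-adjacent         g-aut adj zero    = adj
  orbit-adjacent {g} {a} g-aut adj (suc t) = proj₁ (g-aut _ _) (orbit-adjacent {g} {a} g-aut adj t)

  orbitTuple-walk : ∀ {g a} l → IsAut Γ g → Adj Γ a (g ⟨$⟩ʳ a) → IsWalk Γ (orbitTuple g a l)
  orbitTuple-walk {g} {a} l g-aut adj i =
    subst₂ (Adj Γ) (sym (lookup-inject₁-tabulate (orbit g a) i))
                   (sym (lookup∘tabulate (orbit g a ∘ toℕ) (suc i)))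
                   (orbit-adjacent {g} {a} g-aut adj (toℕ i))

  orbitTuple-cycle : ∀ {g a} l → IsAut Γ g → Adj Γ a (g ⟨$⟩ʳ a) → orbit g a (suc l) ≡ a →
    (∀ {t} → t < l → orbit g a (suc t) ≢ a) → IsCycle Γ (orbitTuple g a l)
  orbitTuple-cycle {g} {a} l g-aut adj closes minimal =
    orbitTuple-walk {g} {a} l g-aut adj , closed , λ i j → injective {i} {j} ∘ lookups {i} {j}
    where
    closed : a ≡ lookup (tabulate (orbit g a ∘ toℕ)) (fromℕ (suc l))
    closed = sym (trans (lookup∘tabulate (orbit g a ∘ toℕ) (fromℕ (suc l)))
                        (trans (cong (orbit g a) (toℕ-fromℕ (suc l))) closes))
    injective : Injective _≡_ _≡_ (orbit g a ∘ toℕ {suc l})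
    injective = distinct⇒injective _ λ {i} {j} i<j →
      orbit-distinct {g = g} {a} minimal i<j (s≤s⁻¹ (toℕ<n j))
    lookups : ∀ {i j} → lookup (tabulate (orbit g a ∘ toℕ)) (inject₁ i)
                      ≡ lookup (tabulate (orbit g a ∘ toℕ)) (inject₁ j) →
              orbit g a (toℕ i) ≡ orbit g a (toℕ j)
    lookups {i} {j} same = trans (sym (lookup-inject₁-tabulate (orbit g a) i))
                                 (trans same (lookup-inject₁-tabulate (orbit g a) j))

⟦_⟧ : ∀ {n} → PermGroup n → Pred (Perm n) 0ℓ
⟦ G ⟧ = _∈G_ G

generated-⊆ : ∀ {n d} (G : PermGroup n) {gs : Fin d → Perm n} →
  (∀ i → gs i ∈ ⟦ G ⟧) → Generated gs ⊆ ⟦ G ⟧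
generated-⊆ G gs∈G (gen i)           = gs∈G i
generated-⊆ G gs∈G (respS g≈h g∈S)   = resp G g≈h (generated-⊆ G gs∈G g∈S)
generated-⊆ G gs∈G idS               = idG G
generated-⊆ G gs∈G (comp g∈S h∈S)    = compG G (generated-⊆ G gs∈G g∈S) (generated-⊆ G gs∈G h∈S)
generated-⊆ G gs∈G (inv g∈S)         = invG G (generated-⊆ G gs∈G g∈S)

module Representatives
  {n} (Γ : Graph n) (connected : Connected Γ)
  (G : PermGroup n) (G≤AutΓ : SubgroupOfAut Γ G) (G-transitive : VertexTransitive G)
  {d} (β : Fin d → Tuple n)
  (β-cycle : ∀ i → ConsistentCycle Γ G (β i))
  (β-complete : ∀ w → ConsistentCycle Γ G w → Σ (Fin d) λ i → InOrbit G (β i) w)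
  (β-overlap : ∀ i j → i ≢ j → OrbitOverlapIs G (β i) (β j) (overlapM (β i) (β j)))
  (gs : Fin d → Perm n)
  (gs-shunt : ∀ i → gs i ∈ ⟦ G ⟧ × IsShunt (gs i) (β i))
  where

  S : Pred (Perm n) 0ℓ
  S = Generated gs

  gs∈G : ∀ i → gs i ∈ ⟦ G ⟧
  gs∈G = proj₁ ∘ gs-shunt

  S⊆G : S ⊆ ⟦ G ⟧
  S⊆G = generated-⊆ G gs∈G

  L : Fin d → ℕ
  L i = suc (len (β i))

  root : Fin d → Fin n
  root i = lookup (vs (β i)) zero

  orb : Fin d → ℕ → Fin n
  orb i = orbit (gs i) (root i)

  β-tabulate : ∀ i → vs (β i) ≡ tabulate (orb i ∘ toℕ)
  β-tabulate i = shunt-tabulate (gs i) (β i) (proj₂ (gs-shunt i))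

  β^-tabulate : ∀ i g → vs (β i ^ g) ≡ tabulate ((g ⟨$⟩ʳ_) ∘ orb i ∘ toℕ)
  β^-tabulate i g =
    trans (cong (map (g ⟨$⟩ʳ_)) (β-tabulate i)) (sym (tabulate-∘ (g ⟨$⟩ʳ_) (orb i ∘ toℕ)))

  β-lookup : ∀ i ι → lookup (vs (β i)) ι ≡ orb i (toℕ ι)
  β-lookup i = shunt-lookup (gs i) (β i) (proj₂ (gs-shunt i))

  β-distinct : ∀ i → Injective _≡_ _≡_ (λ ι → lookup (vs (β i)) (inject₁ ι))
  β-distinct i = proj₂ (proj₂ (proj₁ (β-cycle i))) _ _

  L≤n : ∀ i → L i ≤ n
  L≤n i = injective⇒≤ (β-distinct i)

  root-adjacent : ∀ i → Adj Γ (root i) (orb i 1)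
  root-adjacent i = subst (Adj Γ (root i)) (β-lookup i (suc zero)) (proj₁ (proj₁ (β-cycle i)) zero)

  orb-period : ∀ i → orb i (L i) ≡ root i
  orb-period i = begin
    orb i (L i)                     ≡⟨ cong (orb i) (toℕ-fromℕ (L i)) ⟨
    orb i (toℕ (fromℕ (L i)))       ≡⟨ β-lookup i (fromℕ (L i)) ⟨
    lookup (vs (β i)) (fromℕ (L i)) ≡⟨ proj₁ (proj₂ (proj₁ (β-cycle i))) ⟨
    root i                          ∎

  orb-periodic : ∀ i → Periodic (L i) (orb i)
  orb-periodic i = orbit-periodic {g = gs i} (orb-period i)

  orb-first-return : ∀ i {t} → 0 < t → orb i t ≡ root i → L i ≤ t
  orb-first-return i {t} 0<t returns = ≮⇒≥ λ t<L →
    let ι = fromℕ< t<L in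
    <⇒≢ 0<t (sym (trans (sym (toℕ-fromℕ< t<L)) (cong toℕ (β-distinct i {ι} {zero} (begin
      lookup (vs (β i)) (inject₁ ι) ≡⟨ β-lookup i (inject₁ ι) ⟩
      orb i (toℕ (inject₁ ι))       ≡⟨ cong (orb i) (trans (toℕ-inject₁ ι) (toℕ-fromℕ< t<L)) ⟩
      orb i t                       ≡⟨ returns ⟩
      root i                        ∎)))))

  -- Opaque: the proof computes a minimal period; unfolding it during type checking explodes.
  opaque
    orbit-on-representative : ∀ {h a} → h ∈ ⟦ G ⟧ → Adj Γ a (h ⟨$⟩ʳ a) →
      ∃ λ i → ∃ λ y → y ∈ ⟦ G ⟧ × ∀ t → y ⟨$⟩ʳ orb i t ≡ orbit h a t
    orbit-on-representative {h} {a} h∈G adj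
      with least-witness (λ r → orbit h a (suc r) ≟ a) (orbit-returns h a)
    ... | l , closes , minimal
      with β-complete (orbitTuple h a l)
             ( orbitTuple-cycle Γ {h} {a} l h-aut adj closes minimal
             , orbitTuple-walk Γ {h} {a} l h-aut adj , h , h∈G , orbitTuple-shunt h a l )
      where
      h-aut : IsAut Γ h
      h-aut = G≤AutΓ h h∈G
    ... | i , y , y∈G , βᵢ^y≡cycle
      with tuple-≡-agree {f = (y ⟨$⟩ʳ_) ∘ orb i} {g = orbit h a} βᵢ^y≡cycle (β^-tabulate i y) refl
    ... | refl , agree = i , y , y∈G ,
      periodic-agree (cong (y ⟨$⟩ʳ_) ∘ orb-periodic i) (orbit-periodic {g = h} closes)
        (λ t t<L → agree t (<⇒≤ t<L))

  orb-agree-overlap : ∀ {i j y k} → i ≢ j → y ∈ ⟦ G ⟧ → k ≤ L i → k ≤ L j →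
    Agree k ((y ⟨$⟩ʳ_) ∘ orb i) (orb j) → Agree k (orb i) (orb j)
  orb-agree-overlap {i} {j} {y} i≢j y∈G k≤Li k≤Lj agree =
    overlapM-agree⁻ (β-tabulate i) (β-tabulate j)
      (≤ℤ-trans (overlapM-agree⁺ (β^-tabulate i y) (β^-tabulate j id) k≤Li k≤Lj agree)
                (proj₂ (β-overlap i j i≢j) y id y∈G (idG G)))

  orb-agree⇒period-≤ : ∀ {i j} → Agree (L i) (orb i) (orb j) → L j ≤ L i
  orb-agree⇒period-≤ {i} {j} agree = orb-first-return j z<s (begin
    orb j (L i) ≡⟨ agree (L i) ≤-refl ⟨
    orb i (L i) ≡⟨ orb-period i ⟩
    root i      ≡⟨ agree 0 z≤n ⟩
    root j      ∎)

  orb-same-period : ∀ {i j} → Agree (L i ⊓ L j) (orb i) (orb j) → L i ≡ L j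
  orb-same-period {i} {j} agree with ≤-total (L i) (L j)
  ... | inj₁ Li≤Lj = ≤-antisym Li≤Lj (orb-agree⇒period-≤ (Agree-mono (⊓-glb ≤-refl Li≤Lj) agree))
  ... | inj₂ Lj≤Li =
    ≤-antisym (orb-agree⇒period-≤ (Agree-sym (Agree-mono (⊓-glb Lj≤Li ≤-refl) agree))) Lj≤Li

  orb-agree-everywhere : ∀ {i j} → Agree (L i ⊓ L j) (orb i) (orb j) → ∀ t → orb i t ≡ orb j t
  orb-agree-everywhere {i} {j} agree =
    periodic-agree (orb-periodic i) (subst (λ p → Periodic p (orb j)) (sym Li≡Lj) (orb-periodic j))
      (λ t t<Li → agree t (⊓-glb (<⇒≤ t<Li) (≤-trans (<⇒≤ t<Li) (≤-reflexive Li≡Lj))))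
    where Li≡Lj = orb-same-period agree

  orb-agree : ∀ i j {y} → y ∈ ⟦ G ⟧ → ∀ k →
    Agree k ((y ⟨$⟩ʳ_) ∘ orb i) (orb j) → Agree k (orb i) (orb j)
  orb-agree i j y∈G k agree with i ≟ j
  ... | yes refl = λ _ _ → refl
  ... | no i≢j with ≤-total k (L i ⊓ L j)
  ... | inj₁ k≤m =
    orb-agree-overlap i≢j y∈G (≤-trans k≤m (m⊓n≤m _ _)) (≤-trans k≤m (m⊓n≤n _ _)) agree
  ... | inj₂ m≤k = λ t _ → orb-agree-everywhere
    (orb-agree-overlap i≢j y∈G (m⊓n≤m _ _) (m⊓n≤n _ _) (Agree-mono m≤k agree)) t

  roots-equal : ∀ i j → root i ≡ root j
  roots-equal i j with G-transitive (root i) (root j)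
  ... | y , y∈G , y-root = orb-agree i j y∈G 0 (λ { zero z≤n → y-root }) 0 z≤n

  Fixes : Perm n → Fin d → ℕ → Set
  Fixes z i k = Agree k ((z ⟨$⟩ʳ_) ∘ orb i) (orb i)

  FixesAndSendsInS : Fin d → ℕ → Fin n → Set
  FixesAndSendsInS i k v = ∃ λ s → s ∈ S × Fixes s i k × s ⟨$⟩ʳ orb i (suc k) ≡ v

  NextVertexMatched : Fin d → ℕ → Set
  NextVertexMatched i k =
    ∀ {z} → z ∈ ⟦ G ⟧ → Fixes z i k → FixesAndSendsInS i k (z ⟨$⟩ʳ orb i (suc k))

  next-vertex-matched-beyond-period : ∀ i k → L i ≤ suc k → NextVertexMatched i k
  next-vertex-matched-beyond-period i k Li≤1+k {z} _ z-fixes =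
    id , idS , (λ _ _ → refl) , sym (begin
      z ⟨$⟩ʳ orb i (suc k)       ≡⟨ cong (z ⟨$⟩ʳ_) back ⟩
      z ⟨$⟩ʳ orb i (suc k ∸ L i) ≡⟨ z-fixes _ (m∸n≤m k (len (β i))) ⟩
      orb i (suc k ∸ L i)        ≡⟨ back ⟨
      orb i (suc k)              ∎)
    where back = periodic-∸ (orb-periodic i) Li≤1+k

  fixer-shunt : ∀ {z j k} → Fixes z j k → Agree (suc k) (orbit (z ∘ₚ gs j) (root j)) (orb j)
  fixer-shunt z-fixes zero    _         = refl
  fixer-shunt {z} {j} z-fixes (suc t) (s≤s t≤k) =
    trans (cong ((z ∘ₚ gs j) ⟨$⟩ʳ_) (fixer-shunt {z} {j} z-fixes t (m≤n⇒m≤1+n t≤k)))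
          (cong (gs j ⟨$⟩ʳ_) (z-fixes t t≤k))

  conjugate-by-shunts : ∀ {i j k w} → Agree (suc k) (orb i) (orb j) →
    FixesAndSendsInS i (suc k) (gs j ⟨$⟩ʳ w) → FixesAndSendsInS j k w
  conjugate-by-shunts {i} {j} {k} {w} i≈j (s , s∈S , s-fixes , s-next) =
    (gs i ∘ₚ s) ∘ₚ flip (gs j) , comp (comp (gen i) s∈S) (inv (gen j)) , fixes , next
    where
    fixes : Fixes ((gs i ∘ₚ s) ∘ₚ flip (gs j)) j k
    fixes t t≤k = begin
      gs j ⟨$⟩ˡ (s ⟨$⟩ʳ (gs i ⟨$⟩ʳ orb j t)) ≡⟨ cong (λ x → gs j ⟨$⟩ˡ (s ⟨$⟩ʳ (gs i ⟨$⟩ʳ x)))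
                                                  (i≈j t (m≤n⇒m≤1+n t≤k)) ⟨
      gs j ⟨$⟩ˡ (s ⟨$⟩ʳ orb i (suc t))       ≡⟨ cong (gs j ⟨$⟩ˡ_) (s-fixes (suc t) (s≤s t≤k)) ⟩
      gs j ⟨$⟩ˡ orb i (suc t)                ≡⟨ cong (gs j ⟨$⟩ˡ_) (i≈j (suc t) (s≤s t≤k)) ⟩
      gs j ⟨$⟩ˡ (gs j ⟨$⟩ʳ orb j t)          ≡⟨ inverseˡ (gs j) ⟩
      orb j t                               ∎
    next : ((gs i ∘ₚ s) ∘ₚ flip (gs j)) ⟨$⟩ʳ orb j (suc k) ≡ w
    next = begin
      gs j ⟨$⟩ˡ (s ⟨$⟩ʳ (gs i ⟨$⟩ʳ orb j (suc k))) ≡⟨ cong (λ x → gs j ⟨$⟩ˡ (s ⟨$⟩ʳ (gs i ⟨$⟩ʳ x)))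
                                                        (i≈j (suc k) ≤-refl) ⟨
      gs j ⟨$⟩ˡ (s ⟨$⟩ʳ orb i (suc (suc k)))       ≡⟨ cong (gs j ⟨$⟩ˡ_) s-next ⟩
      gs j ⟨$⟩ˡ (gs j ⟨$⟩ʳ w)                      ≡⟨ inverseˡ (gs j) ⟩
      w                                           ∎

  -- z gⱼ shunts the walk of βⱼ up to vertex k + 1, so the consistent cycle it generates is
  -- some βᵢ^y; conjugating the element matched for βᵢ one step further back serves for βⱼ.
  next-vertex-matched-step : ∀ {k} → (∀ i → NextVertexMatched i (suc k)) →
    ∀ j → NextVertexMatched j k
  next-vertex-matched-step {k} IH j {z} z∈G z-fixes
    with orbit-on-representative {z ∘ₚ gs j} {root j} h∈G h-adjacent
    where
    h∈G : (z ∘ₚ gs j) ∈ ⟦ G ⟧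
    h∈G = compG G z∈G (gs∈G j)
    h-adjacent : Adj Γ (root j) ((z ∘ₚ gs j) ⟨$⟩ʳ root j)
    h-adjacent =
      subst (Adj Γ (root j)) (sym (fixer-shunt {z} {j} z-fixes 1 (s≤s z≤n))) (root-adjacent j)
  ... | i , y , y∈G , y-orbit =
    conjugate-by-shunts {i} {j} {k} i≈j
      (subst (FixesAndSendsInS i (suc k)) y-next (IH i {y} y∈G y-fixes))
    where
    h-orbit = fixer-shunt {z} {j} z-fixes
    i≈j : Agree (suc k) (orb i) (orb j)
    i≈j = orb-agree i j y∈G (suc k) (λ t t≤ → trans (y-orbit t) (h-orbit t t≤))
    y-fixes : Fixes y i (suc k)
    y-fixes t t≤ = trans (y-orbit t) (trans (h-orbit t t≤) (sym (i≈j t t≤)))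
    y-next : y ⟨$⟩ʳ orb i (suc (suc k)) ≡ gs j ⟨$⟩ʳ (z ⟨$⟩ʳ orb j (suc k))
    y-next = trans (y-orbit (suc (suc k)))
                   (cong (λ x → gs j ⟨$⟩ʳ (z ⟨$⟩ʳ x)) (h-orbit (suc k) ≤-refl))

  -- Downward induction on k: once k ≥ n ≥ L i the walk has closed up.
  next-vertex-matched : ∀ i k → NextVertexMatched i k
  next-vertex-matched i k = descend n i k (m≤m+n n k)
    where
    descend : ∀ r i k → n ≤ r + k → NextVertexMatched i k
    descend zero    i k n≤k   =
      next-vertex-matched-beyond-period i k (≤-trans (L≤n i) (m≤n⇒m≤1+n n≤k))
    descend (suc r) i k n≤r+k = next-vertex-matched-step
      (λ i′ → descend r i′ (suc k) (≤-trans n≤r+k (≤-reflexive (sym (+-suc r k))))) i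

  MatchedByS : Perm n → Fin d → ℕ → Set
  MatchedByS w i K = ∃ λ s → s ∈ S × Agree K ((s ⟨$⟩ʳ_) ∘ orb i) ((w ⟨$⟩ʳ_) ∘ orb i)

  matchedByS-suc : ∀ {w i K} → w ∈ ⟦ G ⟧ → MatchedByS w i K → MatchedByS w i (suc K)
  matchedByS-suc {w} {i} {K} w∈G (s , s∈S , s≈w)
    with next-vertex-matched i K (compG G w∈G (invG G (S⊆G s∈S))) z-fixes
    where
    z-fixes : Fixes (w ∘ₚ flip s) i K
    z-fixes t t≤K = trans (cong (s ⟨$⟩ˡ_) (sym (s≈w t t≤K))) (inverseˡ s)
  ... | s₁ , s₁∈S , s₁-fixes , s₁-next =
    s₁ ∘ₚ s , comp s₁∈S s∈S ,
    Agree-suc (λ t t≤K → trans (cong (s ⟨$⟩ʳ_) (s₁-fixes t t≤K)) (s≈w t t≤K))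
              (trans (cong (s ⟨$⟩ʳ_) s₁-next) (inverseʳ s))

  matchedByS-from-root : ∀ {w i} → w ∈ ⟦ G ⟧ → MatchedByS w i 0 → ∀ K → MatchedByS w i K
  matchedByS-from-root w∈G matched zero    = matched
  matchedByS-from-root w∈G matched (suc K) =
    matchedByS-suc w∈G (matchedByS-from-root w∈G matched K)

  S-reaches-neighbours : ∀ i {u} → Adj Γ (root i) u → ∃ λ s → s ∈ S × s ⟨$⟩ʳ root i ≡ u
  S-reaches-neighbours i {u} adj with G-transitive (root i) u
  ... | g , g∈G , g-root
    with orbit-on-representative g∈G (subst (Adj Γ (root i)) (sym g-root) adj)
  ... | j , y , y∈G , y-orbit
    with matchedByS-from-root y∈G
           (id , idS , λ { zero z≤n → sym (trans (y-orbit 0) (roots-equal i j)) }) 1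
  ... | s , s∈S , s≈y = gs j ∘ₚ s , comp (gen j) s∈S , (begin
      s ⟨$⟩ʳ (gs j ⟨$⟩ʳ root i) ≡⟨ cong (λ v → s ⟨$⟩ʳ (gs j ⟨$⟩ʳ v)) (roots-equal i j) ⟩
      s ⟨$⟩ʳ orb j 1            ≡⟨ s≈y 1 ≤-refl ⟩
      y ⟨$⟩ʳ orb j 1            ≡⟨ y-orbit 1 ⟩
      g ⟨$⟩ʳ root i             ≡⟨ g-root ⟩
      u                         ∎)

  S-transitive : ∀ i u → ∃ λ s → s ∈ S × s ⟨$⟩ʳ root i ≡ u
  S-transitive i u = along (connected (root i) u) (id , idS , refl)
    where
    along : ∀ {v w} → Reachable Γ v w → (∃ λ s → s ∈ S × s ⟨$⟩ʳ root i ≡ v) →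
      ∃ λ s → s ∈ S × s ⟨$⟩ʳ root i ≡ w
    along here reached = reached
    along (step {w = v′} adj path) (s , s∈S , s-root) with S-reaches-neighbours i back-adj
      where
      back-adj : Adj Γ (root i) (s ⟨$⟩ˡ v′)
      back-adj = subst (λ x → Adj Γ x (s ⟨$⟩ˡ v′))
                   (trans (cong (s ⟨$⟩ˡ_) (sym s-root)) (inverseˡ s))
                   (proj₁ (G≤AutΓ (flip s) (invG G (S⊆G s∈S)) _ _) adj)
    ... | s′ , s′∈S , s′-root =
      along path (s′ ∘ₚ s , comp s′∈S s∈S , trans (cong (s ⟨$⟩ʳ_) s′-root) (inverseʳ s))

  -- Opaque for the same reason.
  opaque
    S-matches : ∀ i K {w} → w ∈ ⟦ G ⟧ → MatchedByS w i K
    S-matches i K {w} w∈G with S-transitive i (w ⟨$⟩ʳ root i)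
    ... | s , s∈S , s-root = matchedByS-from-root w∈G (s , s∈S , λ { zero z≤n → s-root }) K

  walk-in-S-orbit : ∀ {τ} → Consistent Γ G τ →
    ∃ λ i → ∃ λ σ → σ ∈ S × ∀ ι → lookup (vs τ) ι ≡ σ ⟨$⟩ʳ orb i (toℕ ι)
  walk-in-S-orbit {τ} (walk , t , t∈G , t-shunt) with orbit-on-representative t∈G adj
    where
    adj : Adj Γ (lookup (vs τ) zero) (t ⟨$⟩ʳ lookup (vs τ) zero)
    adj = subst (Adj Γ _) (sym (t-shunt zero)) (walk zero)
  ... | i , y , y∈G , y-orbit with S-matches i (suc (len τ)) y∈G
  ... | σ , σ∈S , σ≈y = i , σ , σ∈S , λ ι → trans (shunt-lookup t τ t-shunt ι)
    (trans (sym (y-orbit (toℕ ι))) (sym (σ≈y (toℕ ι) (s≤s⁻¹ (toℕ<n ι)))))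

  S-agrees-on-walk : ∀ {τ} → Consistent Γ G τ → ∀ {x} → x ∈ ⟦ G ⟧ →
    ∃ λ s → s ∈ S × ∀ ι → s ⟨$⟩ʳ lookup (vs τ) ι ≡ x ⟨$⟩ʳ lookup (vs τ) ι
  S-agrees-on-walk {τ} τ-consistent {x} x∈G with walk-in-S-orbit {τ} τ-consistent
  ... | i , σ , σ∈S , τ-on-orbit with S-matches i (suc (len τ)) (compG G (S⊆G σ∈S) x∈G)
  ... | σ′ , σ′∈S , σ′≈σx = flip σ ∘ₚ σ′ , comp (inv σ∈S) σ′∈S , λ ι → begin
    σ′ ⟨$⟩ʳ (σ ⟨$⟩ˡ lookup (vs τ) ι)          ≡⟨ cong (λ v → σ′ ⟨$⟩ʳ (σ ⟨$⟩ˡ v)) (τ-on-orbit ι) ⟩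
    σ′ ⟨$⟩ʳ (σ ⟨$⟩ˡ (σ ⟨$⟩ʳ orb i (toℕ ι)))   ≡⟨ cong (σ′ ⟨$⟩ʳ_) (inverseˡ σ) ⟩
    σ′ ⟨$⟩ʳ orb i (toℕ ι)                    ≡⟨ σ′≈σx (toℕ ι) (s≤s⁻¹ (toℕ<n ι)) ⟩
    x ⟨$⟩ʳ (σ ⟨$⟩ʳ orb i (toℕ ι))            ≡⟨ cong (x ⟨$⟩ʳ_) (τ-on-orbit ι) ⟨
    x ⟨$⟩ʳ lookup (vs τ) ι                   ∎

  stabiliser-S-factorisation : ∀ {τ} → Consistent Γ G τ → ∀ {x} → x ∈ ⟦ G ⟧ →
    ∃ λ q → ∃ λ s → InStabiliser G τ q × s ∈ S × (q ∘ₚ s) ≈ x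
  stabiliser-S-factorisation {τ} τ-consistent {x} x∈G with S-agrees-on-walk {τ} τ-consistent x∈G
  ... | s , s∈S , s≈x =
    x ∘ₚ flip s , s ,
    (compG G x∈G (invG G (S⊆G s∈S)) , λ ι → trans (cong (s ⟨$⟩ˡ_) (sym (s≈x ι))) (inverseˡ s)) ,
    s∈S , λ _ → inverseʳ s

-- Unused: 3 ≤ n, distinctness of the orbits βᵢᴳ, and H ≤ G (S ≤ G follows from gᵢ ∈ G).
theorem7p3 : ∀ {n : ℕ} → 3 ≤ n → (Γ : Graph n) → Connected Γ →
    (G : PermGroup n) → SubgroupOfAut Γ G → VertexTransitive G →
    (d : ℕ) (β : Fin d → Tuple n) →
    (∀ i → ConsistentCycle Γ G (β i)) →
    (∀ w → ConsistentCycle Γ G w → Σ (Fin d) λ i → InOrbit G (β i) w) →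
    (∀ i j → i ≢ j → ¬ InOrbit G (β i) (β j)) →
    (∀ i j → i ≢ j → OrbitOverlapIs G (β i) (β j) (overlapM (β i) (β j))) →
    (gs : Fin d → Perm n) →
    (∀ i → _∈G_ G (gs i) × IsShunt (gs i) (β i)) →
    (τ : Tuple n) → Consistent Γ G τ →
    (H : PermGroup n) → H ⊆G G →
    (∀ g → InStabiliser G τ g → _∈G_ H g) →
    (∀ g → Generated gs g → _∈G_ H g) →
    G ⊆G H
theorem7p3 _ Γ connected G G≤AutΓ G-transitive _ β β-cycle β-complete _ β-overlap gs gs-shunt
           τ τ-consistent H _ Gτ⊆H S⊆H x x∈G =
  H-contains-factors (stabiliser-S-factorisation {τ} τ-consistent {x} x∈G)
  where
  open Representatives Γ connected G G≤AutΓ G-transitive β β-cycle β-complete β-overlap gs gs-shunt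
  H-contains-factors : (∃ λ q → ∃ λ s → InStabiliser G τ q × s ∈ S × (q ∘ₚ s) ≈ x) → x ∈ ⟦ H ⟧
  H-contains-factors (q , s , q∈Gτ , s∈S , qs≈x) = resp H qs≈x (compG H (Gτ⊆H q q∈Gτ) (S⊆H s s∈S))
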